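{- Let $n_\mathcal{G}=n_\mathcal{H}=2$ and $k_\mathcal{G}=k_\mathcal{H}=1$, and let $(\alpha,\beta)$ be any of $(\sqrt2+3,-\sqrt2-2)$, $(-\sqrt2+3,\sqrt2-2)$, $(\sqrt2-3,-\sqrt2+2)$, $(-\sqrt2-3,\sqrt2+2)$. Then for every $(g,h)\in V(\mathcal{G}\square\mathcal{H})$, letting $(g^*,h^*)$ be the only vertex of $V(\mathcal{G}\square\mathcal{H})$ not in $T_{gh}$, the polynomials $s_{g^*h^*}=x_{g^*h^*}$ and $s_1=-\alpha+\alpha\rho^1_{gh}+\beta\rho^2_{gh}$ form a $2$-SOS-certificate of $f_{\text{viz}}$, i.e. $f_{\text{viz}}\equiv s_{g^*h^*}^2+s_1^2\pmod{I_{\text{viz}}}$; consequently Vizing's conjecture holds for these graph classes.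
   Context: Let $\mathbb{K}\subseteq\mathbb{R}$ be a field containing the numbers used. Let $V(\mathcal{G})=\{g_1,\dots,g_{n_\mathcal{G}}\}$, $V(\mathcal{H})=\{h_1,\dots,h_{n_\mathcal{H}}\}$, $V(\mathcal{G}\square\mathcal{H})=V(\mathcal{G})\times V(\mathcal{H})$; $\mathcal{G}$ ($\mathcal{H}$) is the class of graphs on $V(\mathcal{G})$ ($V(\mathcal{H})$) with minimum dominating set $\{g_1\}$ ($\{h_1\}$). Introduce an edge variable $e_{gg'}=e_{g'g}$ for every unordered pair of distinct $g,g'\in V(\mathcal{G})$, an edge variable $e_{hh'}=e_{h'h}$ for every unordered pair of distinct $h,h'\in V(\mathcal{H})$, and a vertex variable $x_{gh}$ for every $(g,h)\in V(\mathcal{G}\square\mathcal{H})$; let $P$ be the polynomial ring over $\mathbb{K}$ in all these variables. For $k_\mathcal{G}=k_\mathcal{H}=1$ the Vizing ideal $I_{\text{viz}}\subseteq P$ is generated by: $e_{gg'}(e_{gg'}-1)$ for all distinct $g,g'\in V(\mathcal{G})$; $1-e_{gg_1}$ for all $g\ne g_1$; $e_{hh'}(e_{hh'}-1)$ for all distinct $h,h'\in V(\mathcal{H})$; $1-e_{hh_1}$ for all $h\neq h_1$; and, for all $(g,h)$, $x_{gh}(x_{gh}-1)$ and $(1-x_{gh})\prod_{g'\ne g}(1-e_{gg'}x_{g'h})\prod_{h'\neq h}(1-e_{hh'}x_{gh'})$. The Vizing polynomial is $f_{\text{viz}}=\big(\sum_{(g,h)}x_{gh}\big)-k_\mathcal{G}k_\mathcal{H}$.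 A polynomial $f$ is $\ell$-SOS modulo $I$ if $f-\sum_i s_i^2\in I$ for some polynomials $s_i$ of degree at most $\ell$ (an SOS-certificate of degree $\ell$); by prior work, $f_{\text{viz}}$ being $\ell$-SOS modulo $I_{\text{viz}}$ implies $\gamma(G\square H)\ge\gamma(G)\gamma(H)$ for all $G\in\mathcal{G}$, $H\in\mathcal{H}$. For $(g,h)$ let $T_{gh}=\{(g',h') : g'=g\text{ or }h'=h\}$ and $\rho^i_{gh}=\sum_{S\subseteq T_{gh},\,|S|=i}\prod_{(g',h')\in S}x_{g'h'}$. -}

module Defs where

open import Level using (Level; _⊔_)
open import Algebra.Bundles using (CommutativeRing)
open import Data.Nat using (ℕ; zero; suc)
open import Data.Fin using (Fin; zero; suc)
open import Data.Fin.Properties using () renaming (_≟_ to _≟ᶠ_)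
open import Data.List using (List; []; _∷_; length; filter; map)
import Data.List
open import Data.Vec using (Vec; []; _∷_)
open import Data.Product using (Σ; ∃; _×_; _,_; proj₁; proj₂)
open import Data.Sum using (_⊎_)
open import Relation.Nullary using (¬_)
open import Relation.Nullary.Decidable using (_⊎-dec_)

module _ {c ℓ} (R : CommutativeRing c ℓ) where
  open CommutativeRing R using (Carrier; _≈_; _+_; _*_; 0#; 1#)

  natK : ℕ → Carrier
  natK zero    = 0#
  natK (suc n) = 1# + natK n

  record IsCharZeroField : Set (c ⊔ ℓ) where
    field
      nontrivial : ¬ (1# ≈ 0#)
      inverse    : ∀ a → ¬ (a ≈ 0#) → ∃ λ b → a * b ≈ 1#
      charZero   : ∀ n → ¬ (natK (suc n) ≈ 0#)

-- The polynomial ring K[V] over a set of variables V, as the free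
-- commutative K-algebra: polynomial expressions modulo the congruence
-- generated by the commutative-ring axioms and the K-algebra structure.

module _ {c ℓ} (R : CommutativeRing c ℓ) where
  open CommutativeRing R using (Carrier; _≈_; _+_; _*_; -_; 0#; 1#)

  infixl 6 _⊕_
  infixl 7 _⊗_
  infix  4 _≃_

  data Poly (V : Set) : Set c where
    con  : Carrier → Poly V
    var  : V → Poly V
    _⊕_  : Poly V → Poly V → Poly V
    _⊗_  : Poly V → Poly V → Poly V
    ⊝_   : Poly V → Poly V

  data _≃_ {V : Set} : Poly V → Poly V → Set (c ⊔ ℓ) where
    ≃-refl   : ∀ {p} → p ≃ p
    ≃-sym    : ∀ {p q} → p ≃ q → q ≃ p
    ≃-trans  : ∀ {p q r} → p ≃ q → q ≃ r → p ≃ r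
    ⊕-cong   : ∀ {p p′ q q′} → p ≃ p′ → q ≃ q′ → p ⊕ q ≃ p′ ⊕ q′
    ⊗-cong   : ∀ {p p′ q q′} → p ≃ p′ → q ≃ q′ → p ⊗ q ≃ p′ ⊗ q′
    ⊝-cong   : ∀ {p q} → p ≃ q → ⊝ p ≃ ⊝ q
    con-cong : ∀ {a b} → a ≈ b → con a ≃ con b
    con-+    : ∀ a b → con (a + b) ≃ con a ⊕ con b
    con-*    : ∀ a b → con (a * b) ≃ con a ⊗ con b
    con-neg  : ∀ a → con (- a) ≃ ⊝ con a
    ⊕-assoc  : ∀ p q r → (p ⊕ q) ⊕ r ≃ p ⊕ (q ⊕ r)
    ⊕-comm   : ∀ p q → p ⊕ q ≃ q ⊕ p
    ⊕-idˡ    : ∀ p → con 0# ⊕ p ≃ p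
    ⊕-invʳ   : ∀ p → p ⊕ ⊝ p ≃ con 0#
    ⊗-assoc  : ∀ p q r → (p ⊗ q) ⊗ r ≃ p ⊗ (q ⊗ r)
    ⊗-comm   : ∀ p q → p ⊗ q ≃ q ⊗ p
    ⊗-idˡ    : ∀ p → con 1# ⊗ p ≃ p
    ⊗-distribˡ : ∀ p q r → p ⊗ (q ⊕ r) ≃ (p ⊗ q) ⊕ (p ⊗ r)

  _⊖_ : ∀ {V} → Poly V → Poly V → Poly V
  p ⊖ q = p ⊕ ⊝ q

  linComb : ∀ {V} (gs : List (Poly V)) → Vec (Poly V) (length gs) → Poly V
  linComb []       []       = con 0#
  linComb (g ∷ gs) (c ∷ cs) = c ⊗ g ⊕ linComb gs cs

  InIdeal : ∀ {V} → List (Poly V) → Poly V → Set (c ⊔ ℓ)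
  InIdeal gs f = Σ (Vec (Poly _) (length gs)) λ cs → f ≃ linComb gs cs

  CongMod : ∀ {V} → List (Poly V) → Poly V → Poly V → Set (c ⊔ ℓ)
  CongMod gs f q = InIdeal gs (f ⊖ q)

  ΣP : ∀ {V} → List (Poly V) → Poly V
  ΣP []       = con 0#
  ΣP (p ∷ ps) = p ⊕ ΣP ps

  esym : ∀ {V} → ℕ → List (Poly V) → Poly V
  esym zero    _        = con 1#
  esym (suc i) []       = con 0#
  esym (suc i) (p ∷ ps) = p ⊗ esym i ps ⊕ esym (suc i) ps

-- The Vizing setting with n_G = n_H = 2, k_G = k_H = 1.
-- V(G) = {g₁ , g₂} = Fin 2 (g₁ = zero), V(H) = {h₁ , h₂} = Fin 2.
-- Variables: the single edge variable e_{g₁g₂} (= e_{g₂g₁}), the single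
-- edge variable e_{h₁h₂}, and x_{gh} for (g , h) ∈ Fin 2 × Fin 2.

data VizVar : Set where
  eG : VizVar
  eH : VizVar
  x  : Fin 2 → Fin 2 → VizVar

other : Fin 2 → Fin 2
other zero       = suc zero
other (suc zero) = zero

vertices : List (Fin 2 × Fin 2)
vertices = (zero , zero) ∷ (zero , suc zero) ∷ (suc zero , zero) ∷ (suc zero , suc zero) ∷ []

T : Fin 2 → Fin 2 → List (Fin 2 × Fin 2)
T g h = filter (λ v → (proj₁ v ≟ᶠ g) ⊎-dec (proj₂ v ≟ᶠ h)) vertices

module _ {c ℓ} (R : CommutativeRing c ℓ) where
  open CommutativeRing R using (Carrier; _≈_; _+_; _*_; _-_; -_; 0#; 1#)

  P : Set c
  P = Poly R VizVar

  private
    infixl 6 _+ₚ_ _-ₚ_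
    infixl 7 _*ₚ_
    _+ₚ_ _-ₚ_ _*ₚ_ : P → P → P
    _+ₚ_ = _⊕_
    _-ₚ_ = _⊖_ R
    _*ₚ_ = _⊗_
    one : P
    one = con 1#

  X : Fin 2 → Fin 2 → P
  X g h = var (x g h)

  EG EH : P
  EG = var eG
  EH = var eH

  -- generators of I_viz attached to a vertex (g , h):
  --   x_{gh}(x_{gh} - 1)  and
  --   (1 - x_{gh}) ∏_{g'≠g} (1 - e_{gg'} x_{g'h}) ∏_{h'≠h} (1 - e_{hh'} x_{gh'})
  -- (for n = 2 each product has the single factor g' = other g, h' = other h)
  vertexGens : Fin 2 × Fin 2 → List P
  vertexGens (g , h) =
    X g h *ₚ (X g h -ₚ one)
    ∷ (one -ₚ X g h) *ₚ (one -ₚ EG *ₚ X (other g) h) *ₚ (one -ₚ EH *ₚ X g (other h))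
    ∷ []

  vizGens : List P
  vizGens =
    EG *ₚ (EG -ₚ one) ∷ (one -ₚ EG) ∷ EH *ₚ (EH -ₚ one) ∷ (one -ₚ EH)
    ∷ vertexGens (zero , zero) Data.List.++ vertexGens (zero , suc zero)
      Data.List.++ vertexGens (suc zero , zero) Data.List.++ vertexGens (suc zero , suc zero)

  fViz : P
  fViz = ΣP R (map (λ v → X (proj₁ v) (proj₂ v)) vertices) -ₚ con (natK R 1 * natK R 1)

  ρ : ℕ → Fin 2 → Fin 2 → P
  ρ i g h = esym R i (map (λ v → X (proj₁ v) (proj₂ v)) (T g h))

  star : Fin 2 → Fin 2 → Fin 2 × Fin 2
  star g h = (other g , other h)

  sStar : Fin 2 → Fin 2 → P
  sStar g h = X (proj₁ (star g h)) (proj₂ (star g h))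

  s₁ : Carrier → Carrier → Fin 2 → Fin 2 → P
  s₁ α β g h = ⊝ (con α) +ₚ con α *ₚ ρ 1 g h +ₚ con β *ₚ ρ 2 g h

  sumSq : P → P → P
  sumSq s t = s *ₚ s +ₚ t *ₚ t

  -- (α , β) is one of the four admissible pairs, for r a square root of 2
  AdmissiblePair : Carrier → Carrier → Carrier → Set ℓ
  AdmissiblePair r α β =
      (α ≈ r + natK R 3 × β ≈ - r - natK R 2)
    ⊎ (α ≈ - r + natK R 3 × β ≈ r - natK R 2)
    ⊎ (α ≈ r - natK R 3 × β ≈ - r + natK R 2)
    ⊎ (α ≈ - r - natK R 3 × β ≈ r + natK R 2)

module Submission where

-- Modulo I_viz the edge variables equal 1 and the vertex variables are idempotent, so it is enough
-- to prove the identity in a commutative ring in which x_{gh}, x_{g'h}, x_{gh'}, x_{g*h*} are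
-- idempotent and domination gives (1 - x_{gh})(1 - x_{g'h})(1 - x_{gh'}) = 0.  For three
-- idempotents the elementary symmetric functions satisfy σ₁² = σ₁ + 2σ₂, σ₁σ₂ = 2σ₂ + 3σ₃ and
-- σ₂² = σ₂ + 6σ₃, while domination reads σ₃ = 1 - σ₁ + σ₂.  Hence s₁² is a combination of 1 - σ₁
-- and σ₂ whose coefficients are (2α+3β)² - 3(α+β)² and (2α+3β)² - 2(α+β)², i.e. -1 and 0 once
-- (α+β)² = 1 and (2α+3β)² = 2, which holds for the four pairs.  So s₁² = σ₁ - 1, and with
-- x_{g*h*}² = x_{g*h*} this is f_viz.  (On a 0/1 point with k ∈ {1,2,3} of the three variables
-- set, s₁ takes the values 0, α+β, 2α+3β.)

open import Algebra.Bundles using (CommutativeRing; RawRing)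
open import Data.Bool.Base using (Bool; true; false)
open import Data.Maybe.Base using (nothing)
open import Data.Vec.Base using (Vec)
open import Data.Nat.Base as ℕ using (ℕ; zero; suc)
import Data.Nat.Properties as ℕ
open import Data.Integer.Base as ℤ using (ℤ; +_; -[1+_])
import Data.Integer.Properties as ℤ
open import Function.Base using (_∘_)
open import Level using (0ℓ)
open import Relation.Binary.PropositionalEquality as ≡ using (_≡_)
open import Tactic.RingSolver.Core.Expression as Expr
  using (Expr; Κ; Ι) renaming (_⊕_ to _:+_; _⊗_ to _:*_; ⊝_ to :-_)

-- The library's solvers for an abstract commutative ring compute with its own (undecidable)
-- coefficients; mapping ℤ into the ring gives coefficients whose arithmetic normalises.
module IntegerCoefficients {c ℓ} (R : CommutativeRing c ℓ) where
  open CommutativeRing R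
  open import Algebra.Properties.Ring ring using (-0#≈0#; -‿+-comm; -‿involutive; -‿distribˡ-*; -‿distribʳ-*)
  open import Algebra.Properties.Semiring.Mult.TCOptimised semiring using (_×_; 1+×; ×-homo-+; ×1-homo-*)
  open import Relation.Binary.Reasoning.Setoid setoid
  open import Tactic.RingSolver.Core.AlmostCommutativeRing using (fromCommutativeRing)
  open import Tactic.RingSolver.Core.Polynomial.Parameters using (Homomorphism)

  embed : ℤ → Carrier
  embed (+ n)    = n × 1#
  embed -[1+ n ] = - (suc n × 1#)

  embed-neg+ : ∀ n → embed (ℤ.- (+ n)) ≈ - (n × 1#)
  embed-neg+ zero    = sym -0#≈0#
  embed-neg+ (suc n) = refl

  embed-⊖ : ∀ m n → embed (m ℤ.⊖ n) ≈ m × 1# + - (n × 1#)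
  embed-⊖ m       zero    = sym (trans (+-congˡ -0#≈0#) (+-identityʳ _))
  embed-⊖ zero    (suc n) = sym (+-identityˡ _)
  embed-⊖ (suc m) (suc n) = begin
    embed (suc m ℤ.⊖ suc n)              ≡⟨ ≡.cong embed (ℤ.[1+m]⊖[1+n]≡m⊖n m n) ⟩
    embed (m ℤ.⊖ n)                      ≈⟨ embed-⊖ m n ⟩
    m × 1# + - (n × 1#)                  ≈⟨ cancel ⟨
    (1# + m × 1#) + - (1# + n × 1#)      ≈⟨ +-cong (1+× m 1#) (-‿cong (1+× n 1#)) ⟨
    suc m × 1# + - (suc n × 1#)          ∎
    where
    cancel : (1# + m × 1#) + - (1# + n × 1#) ≈ m × 1# + - (n × 1#)
    cancel = begin
      (1# + m × 1#) + - (1# + n × 1#)    ≈⟨ +-cong (+-comm _ _) (sym (-‿+-comm _ _)) ⟩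
      (m × 1# + 1#) + (- 1# + - (n × 1#)) ≈⟨ +-assoc _ _ _ ⟩
      m × 1# + (1# + (- 1# + - (n × 1#))) ≈⟨ +-congˡ (+-assoc _ _ _) ⟨
      m × 1# + ((1# + - 1#) + - (n × 1#)) ≈⟨ +-congˡ (+-congʳ (-‿inverseʳ 1#)) ⟩
      m × 1# + (0# + - (n × 1#))         ≈⟨ +-congˡ (+-identityˡ _) ⟩
      m × 1# + - (n × 1#)                ∎

  embed-+ : ∀ i j → embed (i ℤ.+ j) ≈ embed i + embed j
  embed-+ (+ m)    (+ n)    = ×-homo-+ 1# m n
  embed-+ (+ m)    -[1+ n ] = embed-⊖ m (suc n)
  embed-+ -[1+ m ] (+ n)    = trans (embed-⊖ n (suc m)) (+-comm _ _)
  embed-+ -[1+ m ] -[1+ n ] = begin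
    - (suc (suc (m ℕ.+ n)) × 1#)       ≡⟨ ≡.cong (λ k → - (suc k × 1#)) (ℕ.+-suc m n) ⟨
    - ((suc m ℕ.+ suc n) × 1#)         ≈⟨ -‿cong (×-homo-+ 1# (suc m) (suc n)) ⟩
    - (suc m × 1# + suc n × 1#)        ≈⟨ -‿+-comm _ _ ⟨
    - (suc m × 1#) + - (suc n × 1#)    ∎

  embed-* : ∀ i j → embed (i ℤ.* j) ≈ embed i * embed j
  embed-* (+ m) (+ n) = begin
    embed (+ m ℤ.* + n)      ≡⟨ ≡.cong embed (ℤ.+◃n≡+n (m ℕ.* n)) ⟩
    (m ℕ.* n) × 1#           ≈⟨ ×1-homo-* m n ⟩
    m × 1# * n × 1#          ∎
  embed-* (+ m) -[1+ n ] = begin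
    embed (+ m ℤ.* -[1+ n ]) ≡⟨ ≡.cong embed (ℤ.-◃n≡-n (m ℕ.* suc n)) ⟩
    embed (ℤ.- (+ (m ℕ.* suc n))) ≈⟨ embed-neg+ (m ℕ.* suc n) ⟩
    - ((m ℕ.* suc n) × 1#)   ≈⟨ -‿cong (×1-homo-* m (suc n)) ⟩
    - (m × 1# * suc n × 1#)  ≈⟨ -‿distribʳ-* _ _ ⟩
    m × 1# * - (suc n × 1#)  ∎
  embed-* -[1+ m ] (+ n) = begin
    embed (-[1+ m ] ℤ.* + n) ≡⟨ ≡.cong embed (ℤ.-◃n≡-n (suc m ℕ.* n)) ⟩
    embed (ℤ.- (+ (suc m ℕ.* n))) ≈⟨ embed-neg+ (suc m ℕ.* n) ⟩
    - ((suc m ℕ.* n) × 1#)   ≈⟨ -‿cong (×1-homo-* (suc m) n) ⟩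
    - (suc m × 1# * n × 1#)  ≈⟨ -‿distribˡ-* _ _ ⟩
    - (suc m × 1#) * n × 1#  ∎
  embed-* -[1+ m ] -[1+ n ] = begin
    (suc m ℕ.* suc n) × 1#   ≈⟨ ×1-homo-* (suc m) (suc n) ⟩
    a * b                    ≈⟨ -‿involutive _ ⟨
    - - (a * b)              ≈⟨ -‿cong (-‿distribʳ-* a b) ⟩
    - (a * - b)              ≈⟨ -‿distribˡ-* a (- b) ⟩
    - a * - b                ∎
    where
    a = suc m × 1#
    b = suc n × 1#

  embed-neg : ∀ i → embed (ℤ.- i) ≈ - embed i
  embed-neg (+ zero)  = sym -0#≈0#
  embed-neg (+ suc n) = refl
  embed-neg -[1+ n ]  = sym (-‿involutive _)

  isZero : ℤ → Bool
  isZero (+ zero) = true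
  isZero _        = false

  embedding : Homomorphism 0ℓ 0ℓ c ℓ
  embedding = record
    { from = record { rawRing = ℤ.+-*-rawRing ; isZero = isZero }
    ; to = fromCommutativeRing R (λ _ → nothing)
    ; morphism = record
      { ⟦_⟧ = embed ; +-homo = embed-+ ; *-homo = embed-* ; -‿homo = embed-neg
      ; 0-homo = refl ; 1-homo = refl }
    ; Zero-C⟶Zero-R = λ { (+ zero) _ → refl }
    }

  open import Tactic.RingSolver.Core.Polynomial.Base (Homomorphism.from embedding)
  open import Tactic.RingSolver.Core.Polynomial.Semantics embedding using () renaming (⟦_⟧ to ⟦_⟧ₚ)
  open import Tactic.RingSolver.Core.Polynomial.Homomorphism embedding
  open import Algebra.Properties.Semiring.Exp.TCOptimised semiring using (^-congˡ)
  open Expr.Eval rawRing embed using (⟦_⟧)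

  normalise : ∀ {n} → Expr ℤ n → Poly n
  normalise (Κ x)        = κ x
  normalise (Ι x)        = ι x
  normalise (x :+ y)     = normalise x ⊞ normalise y
  normalise (x :* y)     = normalise x ⊠ normalise y
  normalise (:- x)       = ⊟ normalise x
  normalise (x Expr.⊛ i) = normalise x ⊡ i

  ⟦_⇓⟧ : ∀ {n} → Expr ℤ n → Vec Carrier n → Carrier
  ⟦ e ⇓⟧ = ⟦ normalise e ⟧ₚ

  normalise-correct : ∀ {n} (e : Expr ℤ n) ρ → ⟦ e ⇓⟧ ρ ≈ ⟦ e ⟧ ρ
  normalise-correct (Κ x)        ρ = κ-hom x ρ
  normalise-correct (Ι x)        ρ = ι-hom x ρ
  normalise-correct (x :+ y)     ρ =
    trans (⊞-hom (normalise x) (normalise y) ρ) (+-cong (normalise-correct x ρ) (normalise-correct y ρ))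
  normalise-correct (x :* y)     ρ =
    trans (⊠-hom (normalise x) (normalise y) ρ) (*-cong (normalise-correct x ρ) (normalise-correct y ρ))
  normalise-correct (:- x)       ρ = trans (⊟-hom (normalise x) ρ) (-‿cong (normalise-correct x ρ))
  normalise-correct (x Expr.⊛ i) ρ = trans (⊡-hom (normalise x) i ρ) (^-congˡ i (normalise-correct x ρ))

  open import Relation.Binary.Reflection setoid Ι ⟦_⟧ ⟦_⇓⟧ normalise-correct public using (solve; _⊜_)

exprRawRing : ℕ → RawRing 0ℓ 0ℓ
exprRawRing n = record
  { Carrier = Expr ℤ n ; _≈_ = _≡_
  ; _+_ = _:+_ ; _*_ = _:*_ ; -_ = :-_ ; 0# = Κ (+ 0) ; 1# = Κ (+ 1) }

-- Stated over raw rings so that the same forms are both ring elements and solver expressions.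
module Forms {a ℓ} (R : RawRing a ℓ) where
  open RawRing R
  open import Algebra.Definitions.RawMonoid +-rawMonoid public using () renaming (_×′_ to _×_)

  σ₁ σ₂ σ₃ : Carrier → Carrier → Carrier → Carrier
  σ₁ p q s = p + q + s
  σ₂ p q s = p * q + p * s + q * s
  σ₃ p q s = p * q * s

  s₁-form : Carrier → Carrier → Carrier → Carrier → Carrier
  s₁-form α β x y = - α + α * x + β * y

module DominatedIdempotents {c ℓ} (R : CommutativeRing c ℓ) where
  open CommutativeRing R
  open Forms rawRing
  open IntegerCoefficients R using (solve; _⊜_)
  open import Algebra.Definitions _≈_ using (_IdempotentOn_)
  open import Algebra.Properties.Monoid.Mult.TCOptimised +-monoid using (×-congʳ)
  open import Algebra.Properties.Group +-group using (x∙y⁻¹≈ε⇒x≈y)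
  open import Relation.Binary.Reasoning.Setoid setoid
  private module E {n} = Forms (exprRawRing n)

  record SOSPair (α β : Carrier) : Set ℓ where
    field
      sum-square      : (α + β) * (α + β) ≈ 1#
      weighted-square : (2 × α + 3 × β) * (2 × α + 3 × β) ≈ 2 × 1#

  SOSPair-resp : ∀ {α α′ β β′} → α ≈ α′ → β ≈ β′ → SOSPair α′ β′ → SOSPair α β
  SOSPair-resp α≈ β≈ sos = record
    { sum-square      = trans (*-cong sum≈ sum≈) sum-square
    ; weighted-square = trans (*-cong weighted≈ weighted≈) weighted-square }
    where
    open SOSPair sos
    sum≈ = +-cong α≈ β≈
    weighted≈ = +-cong (×-congʳ 2 α≈) (×-congʳ 3 β≈)

  x[x-1]≈0⇒idempotent : ∀ {x} → x * (x + - 1#) ≈ 0# → _*_ IdempotentOn x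
  x[x-1]≈0⇒idempotent {x} x[x-1]≈0 = begin
    x * x                 ≈⟨ solve 1 (λ x → x :* x ⊜ x :* (x :+ :- Κ (+ 1)) :+ x) refl x ⟩
    x * (x + - 1#) + x    ≈⟨ +-congʳ x[x-1]≈0 ⟩
    0# + x                ≈⟨ +-identityˡ x ⟩
    x                     ∎

  1-x≈0⇒x≈1 : ∀ {x} → 1# + - x ≈ 0# → x ≈ 1#
  1-x≈0⇒x≈1 {x} 1-x≈0 = sym (x∙y⁻¹≈ε⇒x≈y 1# x 1-x≈0)

  module _ {p q s : Carrier}
    (p-idem : _*_ IdempotentOn p) (q-idem : _*_ IdempotentOn q) (s-idem : _*_ IdempotentOn s) where

    σ₁-square : σ₁ p q s * σ₁ p q s ≈ σ₁ p q s + 2 × σ₂ p q s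
    σ₁-square = begin
      σ₁ p q s * σ₁ p q s
        ≈⟨ solve 3 (λ p q s → E.σ₁ p q s :* E.σ₁ p q s ⊜ p :* p :+ q :* q :+ s :* s :+ 2 E.× E.σ₂ p q s) refl p q s ⟩
      p * p + q * q + s * s + 2 × σ₂ p q s
        ≈⟨ +-congʳ (+-cong (+-cong p-idem q-idem) s-idem) ⟩
      σ₁ p q s + 2 × σ₂ p q s ∎

    σ₁σ₂ : σ₁ p q s * σ₂ p q s ≈ 2 × σ₂ p q s + 3 × σ₃ p q s
    σ₁σ₂ = begin
      σ₁ p q s * σ₂ p q s
        ≈⟨ solve 3 (λ p q s → E.σ₁ p q s :* E.σ₂ p q s
                     ⊜ p :* p :* (q :+ s) :+ q :* q :* (p :+ s) :+ s :* s :* (p :+ q) :+ 3 E.× E.σ₃ p q s) refl p q s ⟩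
      p * p * (q + s) + q * q * (p + s) + s * s * (p + q) + 3 × σ₃ p q s
        ≈⟨ +-congʳ (+-cong (+-cong (*-congʳ p-idem) (*-congʳ q-idem)) (*-congʳ s-idem)) ⟩
      p * (q + s) + q * (p + s) + s * (p + q) + 3 × σ₃ p q s
        ≈⟨ solve 3 (λ p q s → p :* (q :+ s) :+ q :* (p :+ s) :+ s :* (p :+ q) :+ 3 E.× E.σ₃ p q s
                     ⊜ 2 E.× E.σ₂ p q s :+ 3 E.× E.σ₃ p q s) refl p q s ⟩
      2 × σ₂ p q s + 3 × σ₃ p q s ∎

    σ₂-square : σ₂ p q s * σ₂ p q s ≈ σ₂ p q s + 6 × σ₃ p q s
    σ₂-square = begin
      σ₂ p q s * σ₂ p q s
        ≈⟨ solve 3 (λ p q s → E.σ₂ p q s :* E.σ₂ p q s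
                     ⊜ p :* p :* (q :* q) :+ p :* p :* (s :* s) :+ q :* q :* (s :* s)
                       :+ 2 E.× (p :* p :* q :* s :+ p :* (q :* q) :* s :+ p :* q :* (s :* s))) refl p q s ⟩
      p * p * (q * q) + p * p * (s * s) + q * q * (s * s) + 2 × (p * p * q * s + p * (q * q) * s + p * q * (s * s))
        ≈⟨ +-cong (+-cong (+-cong (*-cong p-idem q-idem) (*-cong p-idem s-idem)) (*-cong q-idem s-idem))
                  (×-congʳ 2 (+-cong (+-cong (*-congʳ (*-congʳ p-idem)) (*-congʳ (*-congˡ q-idem))) (*-congˡ s-idem))) ⟩
      σ₂ p q s + 2 × (σ₃ p q s + σ₃ p q s + σ₃ p q s)
        ≈⟨ solve 3 (λ p q s → E.σ₂ p q s :+ 2 E.× (E.σ₃ p q s :+ E.σ₃ p q s :+ E.σ₃ p q s)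
                     ⊜ E.σ₂ p q s :+ 6 E.× E.σ₃ p q s) refl p q s ⟩
      σ₂ p q s + 6 × σ₃ p q s ∎

    s₁-form-square : ∀ {α β} → (1# + - p) * (1# + - q) * (1# + - s) ≈ 0# → SOSPair α β →
      s₁-form α β (σ₁ p q s) (σ₂ p q s) * s₁-form α β (σ₁ p q s) (σ₂ p q s) ≈ σ₁ p q s + - 1#
    s₁-form-square {α} {β} dominated sos = begin
      S * S
        ≈⟨ solve 5 (λ α β p q s → let x = E.σ₁ p q s; y = E.σ₂ p q s; S = E.s₁-form α β x y in
             S :* S ⊜ α :* α :* (x :* x) :+ 2 E.× (α :* β) :* (x :* y) :+ β :* β :* (y :* y)
                      :+ :- (2 E.× (α :* α) :* x) :+ :- (2 E.× (α :* β) :* y) :+ α :* α) refl α β p q s ⟩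
      α * α * (x * x) + 2 × (α * β) * (x * y) + β * β * (y * y) + - (2 × (α * α) * x) + - (2 × (α * β) * y) + α * α
        ≈⟨ +-congʳ (+-congʳ (+-congʳ (+-cong (+-cong (*-congˡ σ₁-square) (*-congˡ σ₁σ₂)) (*-congˡ σ₂-square)))) ⟩
      α * α * (x + 2 × y) + 2 × (α * β) * (2 × y + 3 × z) + β * β * (y + 6 × z) + - (2 × (α * α) * x) + - (2 × (α * β) * y) + α * α
        ≈⟨ solve 5 (λ α β p q s →
             let x = E.σ₁ p q s; y = E.σ₂ p q s; z = E.σ₃ p q s
                 U = (α :+ β) :* (α :+ β); W = (2 E.× α :+ 3 E.× β) :* (2 E.× α :+ 3 E.× β)
                 D = (Κ (+ 1) :+ :- p) :* (Κ (+ 1) :+ :- q) :* (Κ (+ 1) :+ :- s) in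
             α :* α :* (x :+ 2 E.× y) :+ 2 E.× (α :* β) :* (2 E.× y :+ 3 E.× z) :+ β :* β :* (y :+ 6 E.× z)
               :+ :- (2 E.× (α :* α) :* x) :+ :- (2 E.× (α :* β) :* y) :+ α :* α
             ⊜ 6 E.× (β :* (α :+ β)) :* :- D :+ (W :+ :- (3 E.× U)) :* (Κ (+ 1) :+ :- x) :+ (W :+ :- (2 E.× U)) :* y)
             refl α β p q s ⟩
      6 × (β * (α + β)) * - D + (W + - (3 × U)) * (1# + - x) + (W + - (2 × U)) * y
        ≈⟨ +-cong (+-cong (*-congˡ (-‿cong dominated)) (*-congʳ (+-cong weighted-square (-‿cong (×-congʳ 3 sum-square)))))
                  (*-congʳ (+-cong weighted-square (-‿cong (×-congʳ 2 sum-square)))) ⟩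
      6 × (β * (α + β)) * - 0# + (2 × 1# + - (3 × 1#)) * (1# + - x) + (2 × 1# + - (2 × 1#)) * y
        ≈⟨ solve 5 (λ α β p q s → let x = E.σ₁ p q s; y = E.σ₂ p q s; 𝟙 = Κ (+ 1) in
             6 E.× (β :* (α :+ β)) :* :- Κ (+ 0) :+ (2 E.× 𝟙 :+ :- (3 E.× 𝟙)) :* (𝟙 :+ :- x) :+ (2 E.× 𝟙 :+ :- (2 E.× 𝟙)) :* y
             ⊜ x :+ :- 𝟙) refl α β p q s ⟩
      x + - 1# ∎
      where
      open SOSPair sos
      x = σ₁ p q s
      y = σ₂ p q s
      z = σ₃ p q s
      S = s₁-form α β x y
      U = (α + β) * (α + β)
      W = (2 × α + 3 × β) * (2 × α + 3 × β)
      D = (1# + - p) * (1# + - q) * (1# + - s)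

  sos-certificate : ∀ {p q s t α β} →
    _*_ IdempotentOn p → _*_ IdempotentOn q → _*_ IdempotentOn s → _*_ IdempotentOn t →
    (1# + - p) * (1# + - q) * (1# + - s) ≈ 0# → SOSPair α β →
    p + q + s + t + - 1# ≈ t * t + s₁-form α β (σ₁ p q s) (σ₂ p q s) * s₁-form α β (σ₁ p q s) (σ₂ p q s)
  sos-certificate {p} {q} {s} {t} {α} {β} p-idem q-idem s-idem t-idem dominated sos = begin
    p + q + s + t + - 1#     ≈⟨ solve 4 (λ p q s t → p :+ q :+ s :+ t :+ :- Κ (+ 1) ⊜ t :+ (E.σ₁ p q s :+ :- Κ (+ 1))) refl p q s t ⟩
    t + (σ₁ p q s + - 1#)    ≈⟨ +-cong t-idem (s₁-form-square p-idem q-idem s-idem dominated sos) ⟨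
    t * t + S * S            ∎
    where
    S = s₁-form α β (σ₁ p q s) (σ₂ p q s)

module PolynomialQuotient {c ℓ} (K : CommutativeRing c ℓ) (V : Set) where
  open import Defs using (Poly; con; _⊕_; _⊗_; ⊝_; _≃_; linComb; InIdeal; CongMod; module _≃_)
  open _≃_
  open CommutativeRing K using (0#; 1#)
  open import Algebra.Definitions using (Congruent₁; Congruent₂)
  open import Algebra.Structures using (IsCommutativeRing)
  open import Data.List.Base using (List; []; _∷_; length)
  open import Data.List.Membership.Propositional using (_∈_)
  open import Data.List.Relation.Unary.Any using (here; there)
  open import Data.Product.Base using (_,_)
  open import Data.Vec.Base using ([]; _∷_; replicate; zipWith; map)
  open import Level using (_⊔_)
  open import Relation.Binary.Core using (Rel)
  open import Relation.Binary.Structures using (IsEquivalence)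

  P : Set c
  P = Poly K V

  isCommutativeRing : ∀ {ℓ′} {_∼_ : Rel P ℓ′} → IsEquivalence _∼_ →
    Congruent₂ _∼_ _⊕_ → Congruent₂ _∼_ _⊗_ → Congruent₁ _∼_ ⊝_ →
    (∀ {p q} → _≃_ K p q → p ∼ q) → IsCommutativeRing _∼_ _⊕_ _⊗_ ⊝_ (con 0#) (con 1#)
  isCommutativeRing isEquivalence ⊕-cong′ ⊗-cong′ ⊝-cong′ ≃⇒∼ = record
    { isRing = record
      { +-isAbelianGroup = record
        { isGroup = record
          { isMonoid = record
            { isSemigroup = record
              { isMagma = record { isEquivalence = isEquivalence ; ∙-cong = ⊕-cong′ }
              ; assoc = λ p q r → ≃⇒∼ (⊕-assoc p q r) }
            ; identity = (λ p → ≃⇒∼ (⊕-idˡ p)) , λ p → ≃⇒∼ (≃-trans (⊕-comm p _) (⊕-idˡ p)) }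
          ; inverse = (λ p → ≃⇒∼ (≃-trans (⊕-comm _ p) (⊕-invʳ p))) , λ p → ≃⇒∼ (⊕-invʳ p)
          ; ⁻¹-cong = ⊝-cong′ }
        ; comm = λ p q → ≃⇒∼ (⊕-comm p q) }
      ; *-cong = ⊗-cong′
      ; *-assoc = λ p q r → ≃⇒∼ (⊗-assoc p q r)
      ; *-identity = (λ p → ≃⇒∼ (⊗-idˡ p)) , λ p → ≃⇒∼ (≃-trans (⊗-comm p _) (⊗-idˡ p))
      ; distrib = (λ p q r → ≃⇒∼ (⊗-distribˡ p q r))
                , λ p q r → ≃⇒∼ (≃-trans (⊗-comm (q ⊕ r) p)
                                  (≃-trans (⊗-distribˡ p q r) (⊕-cong (⊗-comm p q) (⊗-comm p r)))) }
    ; *-comm = λ p q → ≃⇒∼ (⊗-comm p q) }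

  polynomialRing : CommutativeRing c (c ⊔ ℓ)
  polynomialRing = record
    { isCommutativeRing = isCommutativeRing
        (record { refl = ≃-refl ; sym = ≃-sym ; trans = ≃-trans }) ⊕-cong ⊗-cong ⊝-cong (λ p≃q → p≃q) }

  open IntegerCoefficients polynomialRing using (solve; _⊜_)
  open Forms (CommutativeRing.rawRing K) using () renaming (_×_ to _×ₖ_)
  open Forms (CommutativeRing.rawRing polynomialRing) using (_×_)

  con-× : ∀ n a → _≃_ K (con (n ×ₖ a)) (n × con a)
  con-× zero          a = ≃-refl
  con-× (suc zero)    a = ≃-refl
  con-× (suc (suc n)) a = ≃-trans (con-+ _ _) (⊕-cong (con-× (suc n) a) ≃-refl)

  module Quotient (gs : List P) where
    private
      infix 4 _≃ₚ_
      _≃ₚ_ : P → P → Set (c ⊔ ℓ)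
      _≃ₚ_ = _≃_ K
      I : P → Set (c ⊔ ℓ)
      I = InIdeal K gs

    linComb-replicate : ∀ gs → linComb K gs (replicate (length gs) (con 0#)) ≃ₚ con 0#
    linComb-replicate []       = ≃-refl
    linComb-replicate (g ∷ gs) = ≃-trans (⊕-cong ≃-refl (linComb-replicate gs))
      (solve 1 (λ g → Κ (+ 0) :* g :+ Κ (+ 0) ⊜ Κ (+ 0)) ≃-refl g)

    linComb-zipWith : ∀ gs cs ds → linComb K gs (zipWith _⊕_ cs ds) ≃ₚ linComb K gs cs ⊕ linComb K gs ds
    linComb-zipWith []       []       []       = ≃-sym (⊕-idˡ _)
    linComb-zipWith (g ∷ gs) (c ∷ cs) (d ∷ ds) = ≃-trans (⊕-cong ≃-refl (linComb-zipWith gs cs ds))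
      (solve 5 (λ c d g x y → (c :+ d) :* g :+ (x :+ y) ⊜ (c :* g :+ x) :+ (d :* g :+ y))
        ≃-refl c d g (linComb K gs cs) (linComb K gs ds))

    linComb-map : ∀ gs r cs → linComb K gs (map (r ⊗_) cs) ≃ₚ r ⊗ linComb K gs cs
    linComb-map []       r []       = solve 1 (λ r → Κ (+ 0) ⊜ r :* Κ (+ 0)) ≃-refl r
    linComb-map (g ∷ gs) r (c ∷ cs) = ≃-trans (⊕-cong ≃-refl (linComb-map gs r cs))
      (solve 4 (λ r c g x → r :* c :* g :+ r :* x ⊜ r :* (c :* g :+ x)) ≃-refl r c g (linComb K gs cs))

    InIdeal-resp : ∀ {p q} → p ≃ₚ q → I q → I p
    InIdeal-resp p≃q (cs , q≃) = cs , ≃-trans p≃q q≃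

    InIdeal-0 : I (con 0#)
    InIdeal-0 = replicate _ (con 0#) , ≃-sym (linComb-replicate gs)

    InIdeal-+ : ∀ {p q} → I p → I q → I (p ⊕ q)
    InIdeal-+ (cs , p≃) (ds , q≃) = zipWith _⊕_ cs ds , ≃-trans (⊕-cong p≃ q≃) (≃-sym (linComb-zipWith gs cs ds))

    InIdeal-* : ∀ r {p} → I p → I (r ⊗ p)
    InIdeal-* r (cs , p≃) = map (r ⊗_) cs , ≃-trans (⊗-cong ≃-refl p≃) (≃-sym (linComb-map gs r cs))

    InIdeal-generator : ∀ {g} → g ∈ gs → I g
    InIdeal-generator = go
      where
      go : ∀ {gs g} → g ∈ gs → InIdeal K gs g
      go {g ∷ gs} (here ≡.refl) = con 1# ∷ replicate _ (con 0#) ,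
        ≃-trans (solve 1 (λ g → g ⊜ Κ (+ 1) :* g :+ Κ (+ 0)) ≃-refl g) (⊕-cong ≃-refl (≃-sym (linComb-replicate gs)))
      go {h ∷ gs} {g} (there g∈gs) with go g∈gs
      ... | cs , g≃ = con 0# ∷ cs , ≃-trans g≃ (solve 2 (λ h x → x ⊜ Κ (+ 0) :* h :+ x) ≃-refl h (linComb K gs cs))

    infix 4 _≈_
    _≈_ : Rel P (c ⊔ ℓ)
    _≈_ = CongMod K gs

    ≃⇒≈ : ∀ {p q} → p ≃ₚ q → p ≈ q
    ≃⇒≈ {q = q} p≃q = InIdeal-resp (≃-trans (⊕-cong p≃q ≃-refl) (⊕-invʳ q)) InIdeal-0

    ≈-sym : ∀ {p q} → p ≈ q → q ≈ p
    ≈-sym {p} {q} p≈q = InIdeal-resp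
      (solve 2 (λ p q → q :+ :- p ⊜ Κ -[1+ 0 ] :* (p :+ :- q)) ≃-refl p q) (InIdeal-* _ p≈q)

    ≈-trans : ∀ {p q r} → p ≈ q → q ≈ r → p ≈ r
    ≈-trans {p} {q} {r} p≈q q≈r = InIdeal-resp
      (solve 3 (λ p q r → p :+ :- r ⊜ (p :+ :- q) :+ (q :+ :- r)) ≃-refl p q r) (InIdeal-+ p≈q q≈r)

    ⊕-cong≈ : Congruent₂ _≈_ _⊕_
    ⊕-cong≈ {p} {p′} {q} {q′} p≈p′ q≈q′ = InIdeal-resp
      (solve 4 (λ p p′ q q′ → p :+ q :+ :- (p′ :+ q′) ⊜ (p :+ :- p′) :+ (q :+ :- q′)) ≃-refl p p′ q q′)
      (InIdeal-+ p≈p′ q≈q′)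

    ⊗-cong≈ : Congruent₂ _≈_ _⊗_
    ⊗-cong≈ {p} {p′} {q} {q′} p≈p′ q≈q′ = InIdeal-resp
      (solve 4 (λ p p′ q q′ → p :* q :+ :- (p′ :* q′) ⊜ q :* (p :+ :- p′) :+ p′ :* (q :+ :- q′)) ≃-refl p p′ q q′)
      (InIdeal-+ (InIdeal-* q p≈p′) (InIdeal-* p′ q≈q′))

    ⊝-cong≈ : Congruent₁ _≈_ ⊝_
    ⊝-cong≈ {p} {p′} p≈p′ = InIdeal-resp
      (solve 2 (λ p p′ → :- p :+ :- :- p′ ⊜ Κ -[1+ 0 ] :* (p :+ :- p′)) ≃-refl p p′) (InIdeal-* _ p≈p′)

    quotientRing : CommutativeRing c (c ⊔ ℓ)
    quotientRing = record
      { isCommutativeRing = isCommutativeRing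
          (record { refl = ≃⇒≈ ≃-refl ; sym = ≈-sym ; trans = ≈-trans }) ⊕-cong≈ ⊗-cong≈ ⊝-cong≈ ≃⇒≈ }

    generator≈0 : ∀ {g} → g ∈ gs → g ≈ con 0#
    generator≈0 {g} g∈gs = InIdeal-resp (solve 1 (λ g → g :+ :- Κ (+ 0) ⊜ g) ≃-refl g) (InIdeal-generator g∈gs)

    SOSPair-con : ∀ {α β} → DominatedIdempotents.SOSPair K α β →
                  DominatedIdempotents.SOSPair quotientRing (con α) (con β)
    SOSPair-con {α} {β} sos = record
      { sum-square      = ≃⇒≈ (≃-trans (≃-sym (≃-trans (con-* _ _) (⊗-cong sum sum))) (con-cong sum-square))
      ; weighted-square = ≃⇒≈ (≃-trans (≃-sym (≃-trans (con-* _ _) (⊗-cong weighted weighted)))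
                                       (≃-trans (con-cong weighted-square) (con-× 2 1#))) }
      where
      open DominatedIdempotents.SOSPair sos
      sum      = con-+ α β
      weighted = ≃-trans (con-+ _ _) (⊕-cong (con-× 2 α) (con-× 3 β))

open import Defs
open import Data.Fin.Base using (Fin; zero; suc)
open import Data.List.Base using (List; []; _∷_)
open import Data.List.Membership.Propositional using (_∈_)
open import Data.List.Membership.Propositional.Properties using (∈-++⁺ˡ; ∈-++⁺ʳ)
open import Data.List.Relation.Unary.Any using (here; there)
open import Data.Product.Base using (_,_)
open import Data.Sum.Base using (inj₁; inj₂)

module Admissible {c ℓ} (K : CommutativeRing c ℓ) where
  open CommutativeRing K hiding (zero)
  open Forms rawRing using (_×_)
  open DominatedIdempotents K using (SOSPair; SOSPair-resp)
  open IntegerCoefficients K using (solve; _⊜_)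
  private
    module E {n} = Forms (exprRawRing n)

    -- Evaluates to natK K n itself (not n × 1#), so the solver's goals match AdmissiblePair.
    nat : ℕ → Expr ℤ 1
    nat zero    = Κ (+ 0)
    nat (suc n) = Κ (+ 1) :+ nat n

    sum-square weighted-square : Expr ℤ 1 → Expr ℤ 1 → Expr ℤ 1
    sum-square      a b = (a :+ b) :* (a :+ b)
    weighted-square a b = (2 E.× a :+ 3 E.× b) :* (2 E.× a :+ 3 E.× b)

    pair : ∀ {r α β} → r * r ≈ natK K 2 →
      (α + β) * (α + β) ≈ 1# → (2 × α + 3 × β) * (2 × α + 3 × β) ≈ r * r → SOSPair α β
    pair r²≈2 s w = record { sum-square = s ; weighted-square = trans w (trans r²≈2 (+-congˡ (+-identityʳ 1#))) }

  admissible⇒SOSPair : ∀ {r α β} → r * r ≈ natK K 2 → AdmissiblePair K r α β → SOSPair α β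
  admissible⇒SOSPair {r} r²≈2 (inj₁ (α≈ , β≈)) = SOSPair-resp α≈ β≈ (pair r²≈2
    (solve 1 (λ r → sum-square      (r :+ nat 3) (:- r :+ :- nat 2) ⊜ Κ (+ 1)) refl r)
    (solve 1 (λ r → weighted-square (r :+ nat 3) (:- r :+ :- nat 2) ⊜ r :* r) refl r))
  admissible⇒SOSPair {r} r²≈2 (inj₂ (inj₁ (α≈ , β≈))) = SOSPair-resp α≈ β≈ (pair r²≈2
    (solve 1 (λ r → sum-square      (:- r :+ nat 3) (r :+ :- nat 2) ⊜ Κ (+ 1)) refl r)
    (solve 1 (λ r → weighted-square (:- r :+ nat 3) (r :+ :- nat 2) ⊜ r :* r) refl r))
  admissible⇒SOSPair {r} r²≈2 (inj₂ (inj₂ (inj₁ (α≈ , β≈)))) = SOSPair-resp α≈ β≈ (pair r²≈2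
    (solve 1 (λ r → sum-square      (r :+ :- nat 3) (:- r :+ nat 2) ⊜ Κ (+ 1)) refl r)
    (solve 1 (λ r → weighted-square (r :+ :- nat 3) (:- r :+ nat 2) ⊜ r :* r) refl r))
  admissible⇒SOSPair {r} r²≈2 (inj₂ (inj₂ (inj₂ (α≈ , β≈)))) = SOSPair-resp α≈ β≈ (pair r²≈2
    (solve 1 (λ r → sum-square      (:- r :+ :- nat 3) (r :+ nat 2) ⊜ Κ (+ 1)) refl r)
    (solve 1 (λ r → weighted-square (:- r :+ :- nat 3) (r :+ nat 2) ⊜ r :* r) refl r))

module Vizing {c ℓ} (K : CommutativeRing c ℓ) where
  open PolynomialQuotient K VizVar using (module Quotient)
  open Quotient (vizGens K) using (quotientRing; generator≈0; ≃⇒≈; SOSPair-con)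
  open CommutativeRing quotientRing hiding (zero)
  open Forms rawRing using (σ₁; σ₂; s₁-form)
  open DominatedIdempotents quotientRing
  open IntegerCoefficients quotientRing using (solve; _⊜_)
  open import Algebra.Definitions _≈_ using (_IdempotentOn_)
  open import Relation.Binary.Reasoning.Setoid setoid
  private module E {n} = Forms (exprRawRing n)

  private
    gens₀₀ gens₀₁ : List (P K)
    gens₀₀ = vertexGens K (zero , zero)
    gens₀₁ = vertexGens K (zero , suc zero)

  vertexGens⊆vizGens : ∀ g h {p} → p ∈ vertexGens K (g , h) → p ∈ vizGens K
  vertexGens⊆vizGens zero       zero       = there ∘ there ∘ there ∘ there ∘ ∈-++⁺ˡ
  vertexGens⊆vizGens zero       (suc zero) = there ∘ there ∘ there ∘ there ∘ ∈-++⁺ʳ gens₀₀ ∘ ∈-++⁺ˡ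
  vertexGens⊆vizGens (suc zero) zero       =
    there ∘ there ∘ there ∘ there ∘ ∈-++⁺ʳ gens₀₀ ∘ ∈-++⁺ʳ gens₀₁ ∘ ∈-++⁺ˡ
  vertexGens⊆vizGens (suc zero) (suc zero) =
    there ∘ there ∘ there ∘ there ∘ ∈-++⁺ʳ gens₀₀ ∘ ∈-++⁺ʳ gens₀₁ ∘ ∈-++⁺ʳ (vertexGens K (suc zero , zero))

  x-gh x-g′h x-gh′ : Fin 2 → Fin 2 → P K
  x-gh  g h = X K g h
  x-g′h g h = X K (other g) h
  x-gh′ g h = X K g (other h)

  X-idempotent : ∀ g h → _*_ IdempotentOn X K g h
  X-idempotent g h = x[x-1]≈0⇒idempotent (generator≈0 (vertexGens⊆vizGens g h (here ≡.refl)))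

  EG≈1 : EG K ≈ 1#
  EG≈1 = 1-x≈0⇒x≈1 (generator≈0 (there (here ≡.refl)))

  EH≈1 : EH K ≈ 1#
  EH≈1 = 1-x≈0⇒x≈1 (generator≈0 (there (there (there (here ≡.refl)))))

  dominated : ∀ g h → (1# + - x-gh g h) * (1# + - x-g′h g h) * (1# + - x-gh′ g h) ≈ 0#
  dominated g h = trans (sym (*-cong (*-congˡ (edge≈1 EG≈1)) (edge≈1 EH≈1)))
                        (generator≈0 (vertexGens⊆vizGens g h (there (here ≡.refl))))
    where
    edge≈1 : ∀ {e y} → e ≈ 1# → 1# + - (e * y) ≈ 1# + - y
    edge≈1 {y = y} e≈1 = +-congˡ (-‿cong (trans (*-congʳ e≈1) (*-identityˡ y)))

  esym₁-triple : ∀ a b c → esym K 1 (a ∷ b ∷ c ∷ []) ≈ σ₁ a b c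
  esym₁-triple = solve 3 (λ a b c → a :* Κ (+ 1) :+ (b :* Κ (+ 1) :+ (c :* Κ (+ 1) :+ Κ (+ 0))) ⊜ E.σ₁ a b c) refl

  esym₂-triple : ∀ a b c → esym K 2 (a ∷ b ∷ c ∷ []) ≈ σ₂ a b c
  esym₂-triple = solve 3 (λ a b c →
    a :* (b :* Κ (+ 1) :+ (c :* Κ (+ 1) :+ Κ (+ 0))) :+ (b :* (c :* Κ (+ 1) :+ Κ (+ 0)) :+ (c :* Κ (+ 0) :+ Κ (+ 0)))
    ⊜ E.σ₂ a b c) refl

  -- T g h lists its three vertices in vertex order, a (g,h)-dependent permutation of gh, g′h, gh′.
  ρ₁-local : ∀ g h → ρ K 1 g h ≈ σ₁ (x-gh g h) (x-g′h g h) (x-gh′ g h)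
  ρ₁-local zero       zero       = trans (esym₁-triple _ _ _) (solve 3 (λ u v w → E.σ₁ u w v ⊜ E.σ₁ u v w) refl _ _ _)
  ρ₁-local zero       (suc zero) = trans (esym₁-triple _ _ _) (solve 3 (λ u v w → E.σ₁ w u v ⊜ E.σ₁ u v w) refl _ _ _)
  ρ₁-local (suc zero) zero       = trans (esym₁-triple _ _ _) (solve 3 (λ u v w → E.σ₁ v u w ⊜ E.σ₁ u v w) refl _ _ _)
  ρ₁-local (suc zero) (suc zero) = trans (esym₁-triple _ _ _) (solve 3 (λ u v w → E.σ₁ v w u ⊜ E.σ₁ u v w) refl _ _ _)

  ρ₂-local : ∀ g h → ρ K 2 g h ≈ σ₂ (x-gh g h) (x-g′h g h) (x-gh′ g h)
  ρ₂-local zero       zero       = trans (esym₂-triple _ _ _) (solve 3 (λ u v w → E.σ₂ u w v ⊜ E.σ₂ u v w) refl _ _ _)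
  ρ₂-local zero       (suc zero) = trans (esym₂-triple _ _ _) (solve 3 (λ u v w → E.σ₂ w u v ⊜ E.σ₂ u v w) refl _ _ _)
  ρ₂-local (suc zero) zero       = trans (esym₂-triple _ _ _) (solve 3 (λ u v w → E.σ₂ v u w ⊜ E.σ₂ u v w) refl _ _ _)
  ρ₂-local (suc zero) (suc zero) = trans (esym₂-triple _ _ _) (solve 3 (λ u v w → E.σ₂ v w u ⊜ E.σ₂ u v w) refl _ _ _)

  vertex-sum : ∀ g h → X K zero zero + (X K zero (suc zero) + (X K (suc zero) zero + (X K (suc zero) (suc zero) + 0#)))
                       ≈ x-gh g h + x-g′h g h + x-gh′ g h + sStar K g h
  vertex-sum zero       zero       = solve 4 (λ a b c d → a :+ (b :+ (c :+ (d :+ Κ (+ 0)))) ⊜ a :+ c :+ b :+ d) refl _ _ _ _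
  vertex-sum zero       (suc zero) = solve 4 (λ a b c d → a :+ (b :+ (c :+ (d :+ Κ (+ 0)))) ⊜ b :+ d :+ a :+ c) refl _ _ _ _
  vertex-sum (suc zero) zero       = solve 4 (λ a b c d → a :+ (b :+ (c :+ (d :+ Κ (+ 0)))) ⊜ c :+ a :+ d :+ b) refl _ _ _ _
  vertex-sum (suc zero) (suc zero) = solve 4 (λ a b c d → a :+ (b :+ (c :+ (d :+ Κ (+ 0)))) ⊜ d :+ b :+ c :+ a) refl _ _ _ _

  fViz-local : ∀ g h → fViz K ≈ x-gh g h + x-g′h g h + x-gh′ g h + sStar K g h + - 1#
  fViz-local g h = +-cong (vertex-sum g h) (-‿cong (≃⇒≈ (con-cong 1·1≈1)))
    where
    open CommutativeRing K using () renaming (trans to transₖ; *-cong to *-congₖ; +-identityʳ to +-identityʳₖ; *-identityʳ to *-identityʳₖ)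
    1·1≈1 = transₖ (*-congₖ (+-identityʳₖ _) (+-identityʳₖ _)) (*-identityʳₖ _)

  s₁-local : ∀ α β g h →
    s₁ K α β g h ≈ s₁-form (con α) (con β) (σ₁ (x-gh g h) (x-g′h g h) (x-gh′ g h)) (σ₂ (x-gh g h) (x-g′h g h) (x-gh′ g h))
  s₁-local α β g h = +-cong (+-congˡ (*-congˡ (ρ₁-local g h))) (*-congˡ (ρ₂-local g h))

  fViz≈sumSq : ∀ {α β} → DominatedIdempotents.SOSPair K α β → ∀ g h → fViz K ≈ sumSq K (sStar K g h) (s₁ K α β g h)
  fViz≈sumSq {α} {β} sos g h = begin
    fViz K
      ≈⟨ fViz-local g h ⟩
    x-gh g h + x-g′h g h + x-gh′ g h + sStar K g h + - 1#
      ≈⟨ sos-certificate (X-idempotent g h) (X-idempotent (other g) h) (X-idempotent g (other h))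
                         (X-idempotent (other g) (other h)) (dominated g h) (SOSPair-con sos) ⟩
    sStar K g h * sStar K g h + S * S
      ≈⟨ +-congˡ (*-cong (s₁-local α β g h) (s₁-local α β g h)) ⟨
    sumSq K (sStar K g h) (s₁ K α β g h) ∎
    where
    S = s₁-form (con α) (con β) (σ₁ (x-gh g h) (x-g′h g h) (x-gh′ g h)) (σ₂ (x-gh g h) (x-g′h g h) (x-gh′ g h))

-- The certificate is valid over every commutative ring.
theorem4p3 : ∀ {c ℓ} (K : CommutativeRing c ℓ) → IsCharZeroField K →
    (r : CommutativeRing.Carrier K) →
    CommutativeRing._≈_ K (CommutativeRing._*_ K r r) (natK K 2) →
    (α β : CommutativeRing.Carrier K) → AdmissiblePair K r α β →
    (g h : Fin 2) →
    CongMod K (vizGens K) (fViz K) (sumSq K (sStar K g h) (s₁ K α β g h))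
theorem4p3 K _ r r²≈2 α β admissible = Vizing.fViz≈sumSq K (Admissible.admissible⇒SOSPair K r²≈2 admissible)
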